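{- Let $(X,R)$ be a forcing network and let $G$ be an $X$-colored graph with $n$ vertices. Then the multi-color forcing process with propagation, applying $(X,R)$ to $G$, terminates after at most $n-1$ propagating forcing steps (counting only propagating forcing steps in which at least one vertex changes color).
   Context: Let $X\subseteq\{1,\dots,N\}$ be a finite set of colors. An $X$-colored graph is a finite simple graph $G$ together with an assignment of a color from $X$ to each vertex. A forcing network is a pair $(X,R)$ where $R=(r_1,\dots,r_m)$ is an ordered list of color change rules, each of the form $a\to b$ with $a,b\in X$, $a\neq b$. A forcing step with rule $a\to b$ means: simultaneously recolor with color $a$ every vertex of color $b$ that has at least one neighbor of color $a$ (a vertex may force even if it has several neighbors of color $b$). A propagating forcing step with rule $a\to b$ means performing forcing steps with this rule repeatedly until no vertex of color $b$ has a neighbor of color $a$ (so newly recolored vertices may force further within the same propagating step). In the multi-color forcing process with propagation, the rules are applied as propagating forcing steps in the cyclic order $r_1,\dots,r_m,r_1,\dots,r_m,\dots$; the process terminates when no rule $a\to b\in R$ can be applied, i.e. no edge of $G$ joins a vertex of color $a$ to a vertex of color $b$ for any $a\to b\in R$. -}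

module Defs where

open import Data.Nat using (ℕ; zero; suc; _+_; _<_)
open import Data.Nat.DivMod using (_%_)
open import Data.Bool using (Bool; true; false; _∧_; not; if_then_else_)
open import Data.Fin using (Fin; _≟_)
open import Data.Fin.Subset using (Subset; _∈_)
open import Data.List using (List; []; _∷_; length; allFin; lookup)
open import Data.Bool.ListAction using (any)
open import Data.List.Relation.Unary.All using (All)
open import Data.Maybe using (Maybe; just; nothing)
open import Data.Product using (Σ; ∃; ∃₂; _×_; _,_)
open import Relation.Nullary using (¬_; does)
open import Relation.Binary.PropositionalEquality using (_≡_; _≢_)

record SimpleGraph (n : ℕ) : Set where
  field
    adj   : Fin n → Fin n → Bool
    sym   : ∀ u v → adj u v ≡ adj v u
    irrfl : ∀ v → adj v v ≡ false
open SimpleGraph public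

-- Colors are elements of {1,…,N}, represented (shifted by one) by Fin N.
Color : ℕ → Set
Color N = Fin N

record Rule (N : ℕ) : Set where
  constructor _⇒_
  field
    from : Color N
    to   : Color N
open Rule public

record ForcingNetwork (N : ℕ) : Set where
  field
    X       : Subset N
    rules   : List (Rule N)
    wf      : All (λ r → from r ∈ X × to r ∈ X × from r ≢ to r) rules
open ForcingNetwork public

Coloring : ℕ → ℕ → Set
Coloring N n = Fin n → Color N

ColoredBy : ∀ {N n} → Subset N → Coloring N n → Set
ColoredBy X col = ∀ v → col v ∈ X

hasNbrOfColor : ∀ {N n} → SimpleGraph n → Coloring N n → Color N → Fin n → Bool
hasNbrOfColor {n = n} G col a v = any (λ u → adj G v u ∧ does (col u ≟ a)) (allFin n)

forceStep : ∀ {N n} → SimpleGraph n → Rule N → Coloring N n → Coloring N n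
forceStep G (a ⇒ b) col v =
  if does (col v ≟ b) ∧ hasNbrOfColor G col a v then a else col v

iter : ∀ {A : Set} → (A → A) → ℕ → A → A
iter f zero    x = x
iter f (suc k) x = f (iter f k x)

Applicable : ∀ {N n} → SimpleGraph n → Rule N → Coloring N n → Set
Applicable G (a ⇒ b) col =
  ∃₂ λ u v → adj G u v ≡ true × col u ≡ a × col v ≡ b

PropStep : ∀ {N n} → SimpleGraph n → Rule N → Coloring N n → Coloring N n → Set
PropStep G r col col' =
  (∃ λ k → ∀ v → iter (forceStep G r) k col v ≡ col' v) × ¬ Applicable G r col'

-- The rule used in the t-th propagating step (t = 0,1,2,…): r_{t mod m}.
-- (nothing if R is empty)
ruleAt : ∀ {N} → List (Rule N) → ℕ → Maybe (Rule N)
ruleAt []         t = nothing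
ruleAt R@(_ ∷ _)  t = just (lookup R (Data.Fin.fromℕ< (Data.Nat.DivMod.m%n<n t (length R))))

IsRun : ∀ {N n} → SimpleGraph n → List (Rule N) → Coloring N n → (ℕ → Coloring N n) → Set
IsRun G R col₀ seq =
  (∀ v → seq 0 v ≡ col₀ v) ×
  (∀ t r → ruleAt R t ≡ just r → PropStep G r (seq t) (seq (suc t)))

Terminal : ∀ {N n} → SimpleGraph n → List (Rule N) → Coloring N n → Set
Terminal G R col = All (λ r → ¬ Applicable G r col) R

changedᵇ : ∀ {N n} → Coloring N n → Coloring N n → Bool
changedᵇ {n = n} col col' = any (λ v → not (does (col v ≟ col' v))) (allFin n)

numChanging : ∀ {N n} → (ℕ → Coloring N n) → ℕ → ℕ
numChanging seq zero    = zero
numChanging seq (suc T) =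
  numChanging seq T + (if changedᵇ (seq T) (seq (suc T)) then 1 else 0)

-- Call two vertices monochromatically connected if a path of equally coloured
-- vertices joins them. A propagating step with a → b never separates
-- connected vertices: a-coloured vertices stay a, and a surviving edge
-- between a b-vertex and an a-vertex would contradict propagation. A vertex
-- that changes colour joins, through the chain of forcings that reached it,
-- the component of an a-vertex it was not connected to before. So every
-- changing step strictly merges components, and components can merge at most
-- n − 1 times; counted precisely, the vertices that are not the least element
-- of their component form a set that grows strictly with every changing step
-- and never contains vertex 0. For termination, a full round of rules without
-- change leaves every rule inapplicable, and there are at most n − 1 rounds
-- with change.
module Submission where

open import Defs
open import Data.Nat using (ℕ; _≤_; _<_; _∸_)
open import Data.Product using (Σ; ∃; _×_)
open import Relation.Nullary using (¬_)

open import Data.Bool using (true; false; not; T; if_then_else_)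
import Data.Bool.Properties as Bool
open import Data.Empty using (⊥-elim)
open import Data.Fin as Fin using (Fin; zero; suc; toℕ; fromℕ<; _≟_)
open import Data.Fin.Induction as Fin using ()
open import Data.Fin.Properties using (any?; ∀-cons; <-cmp; toℕ<n; toℕ-fromℕ<; toℕ-injective)
open import Data.Fin.Subset using (Subset; inside; outside; _∈_; _⊆_; _⊂_; ∣_∣)
open import Data.Fin.Subset.Properties using (p⊆q⇒∣p∣≤∣q∣; p⊂q⇒∣p∣<∣q∣; ∣p∣≤n)
open import Data.List using (List; []; _∷_; length; allFin; lookup)
open import Data.List.Membership.Propositional using (lose)
open import Data.List.Membership.Propositional.Properties using (∈-allFin)
open import Data.List.Relation.Unary.All as All using (All; [])
open import Data.List.Relation.Unary.Any as Any using (satisfied)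
open import Data.List.Relation.Unary.Any.Properties using (any⁺; any⁻; lookup-index)
open import Data.Maybe using (just)
open import Data.Nat as ℕ using (zero; suc; z≤n; s≤s; _+_; _*_)
open import Data.Nat.Induction as ℕ using ()
open import Data.Nat.Properties
  using (_≤?_; ≤-refl; <⇒≤; ≤-trans; ≤-reflexive; +-comm; +-identityʳ; +-monoˡ-≤; m≤n+m; m≤m+n;
         ≤-pred; m≤n⇒m<n∨m≡n; m≤n⇒m≤1+n; m∸n≤m; 1+n≰n; anyUpTo?; module ≤-Reasoning)
open import Data.Nat.DivMod using ([m+kn]%n≡m%n; m<n⇒m%n≡m)
open import Data.Product using (_,_; proj₁; proj₂)
open import Data.Sum using (_⊎_; inj₁; inj₂)
open import Data.Vec as Vec using (tabulate)
open import Data.Vec.Properties using (lookup∘tabulate; lookup⇒[]=; []=⇒lookup)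
open import Function using (_∘_; Equivalence)
open import Induction.WellFounded using (Acc; acc)
open import Level using (0ℓ)
open import Relation.Binary.Core using (Rel)
open import Relation.Binary.Definitions using (tri<; tri≈; tri>)
open import Relation.Binary.Construct.Closure.ReflexiveTransitive as Star
  using (Star; ε; _◅_; _◅◅_; reverse)
open import Relation.Binary.PropositionalEquality as ≡
  using (_≡_; _≢_; _≗_; refl; trans; cong; subst)
open import Relation.Nullary using (Dec; yes; no; does; ¬?; _×-dec_)
open import Relation.Nullary.Decidable using (T?; decidable-stable; dec-true; ¬¬-excluded-middle)
open import Relation.Unary using (Decidable)

private
  variable
    N n : ℕ

¬¬-∀-Fin : ∀ {k} {P : Fin k → Set} → (∀ i → ¬ ¬ P i) → ¬ ¬ (∀ i → P i)
¬¬-∀-Fin {zero}  _  ¬all = ¬all λ ()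
¬¬-∀-Fin {suc k} ¬¬P ¬all =
  ¬¬P zero λ P₀ → ¬¬-∀-Fin (¬¬P ∘ suc) λ Pₛ → ¬all (∀-cons P₀ Pₛ)

leastWitness : ∀ {P : ℕ → Set} → Decidable P → ∀ {T₀} → P T₀ →
               ∃ λ T → P T × (∀ t → t < T → ¬ P t)
leastWitness {P} P? {T₀} PT₀ = go T₀ (ℕ.<-wellFounded T₀) PT₀
  where
  go : ∀ T → Acc _<_ T → P T → ∃ λ T → P T × (∀ t → t < T → ¬ P t)
  go T (acc smaller) PT with anyUpTo? P? T
  ... | yes (t , t<T , Pt) = go t (smaller t<T) Pt
  ... | no none             = T , PT , λ t t<T Pt → none (t , t<T , Pt)

fromDec : ∀ {P : Fin n → Set} → Decidable P → Subset n
fromDec P? = tabulate (does ∘ P?)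

∈-fromDec⁺ : ∀ {P : Fin n → Set} (P? : Decidable P) {v} → P v → v ∈ fromDec P?
∈-fromDec⁺ P? {v} Pv = lookup⇒[]= v _ (trans (lookup∘tabulate _ v) (dec-true (P? v) Pv))

∈-fromDec⁻ : ∀ {P : Fin n → Set} (P? : Decidable P) {v} → v ∈ fromDec P? → P v
∈-fromDec⁻ P? {v} v∈ with P? v | trans (≡.sym (lookup∘tabulate _ v)) ([]=⇒lookup v∈)
... | yes Pv | _  = Pv
... | no  _  | ()

fromDec-⊆ : ∀ {P Q : Fin n → Set} (P? : Decidable P) (Q? : Decidable Q) →
            (∀ {v} → P v → Q v) → fromDec P? ⊆ fromDec Q?
fromDec-⊆ P? Q? P⇒Q = ∈-fromDec⁺ Q? ∘ P⇒Q ∘ ∈-fromDec⁻ P?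

fromDec-⊂ : ∀ {P Q : Fin n → Set} (P? : Decidable P) (Q? : Decidable Q) →
            (∀ {v} → P v → Q v) → ∀ {w} → Q w → ¬ P w → fromDec P? ⊂ fromDec Q?
fromDec-⊂ P? Q? P⇒Q Qw ¬Pw = fromDec-⊆ P? Q? P⇒Q , _ , ∈-fromDec⁺ Q? Qw , ¬Pw ∘ ∈-fromDec⁻ P?

∣p∣≤n∸1 : (p : Subset n) → (∀ {v} → v ∈ p → ∃ λ (u : Fin n) → u Fin.< v) → ∣ p ∣ ≤ n ∸ 1
∣p∣≤n∸1 Vec.[]            _       = z≤n
∣p∣≤n∸1 (outside Vec.∷ p) _       = ∣p∣≤n p
∣p∣≤n∸1 (inside  Vec.∷ p) smaller with smaller {zero} Vec.here
... | _ , ()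

hasNbrOfColor-sound : ∀ (G : SimpleGraph n) (c : Coloring N n) a v →
                      T (hasNbrOfColor G c a v) → ∃ λ u → adj G u v ≡ true × c u ≡ a
hasNbrOfColor-sound G c a v found with satisfied (any⁻ _ (allFin _) found)
... | u , edge∧colour with adj G v u in vu | c u ≟ a
...   | true  | yes cu≡a = u , trans (sym G u v) vu , cu≡a
...   | true  | no _     = ⊥-elim edge∧colour
...   | false | _        = ⊥-elim edge∧colour

changedᵇ-sound : ∀ (c c' : Coloring N n) → T (changedᵇ c c') → ∃ λ v → c v ≢ c' v
changedᵇ-sound c c' changed with satisfied (any⁻ _ (allFin _) changed)
... | v , differs with c v ≟ c' v
...   | no cv≢c'v = v , cv≢c'v
...   | yes _     = ⊥-elim differs

changedᵇ-complete : ∀ (c c' : Coloring N n) → ¬ T (changedᵇ c c') → c ≗ c'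
changedᵇ-complete c c' unchanged v with c v ≟ c' v in differs
... | yes cv≡c'v = cv≡c'v
... | no  _      =
  ⊥-elim (unchanged (any⁺ _ (lose (∈-allFin v) (subst (T ∘ not ∘ does) (≡.sym differs) _))))

module _ (G : SimpleGraph n) where

  SameColourEdge : Coloring N n → Rel (Fin n) 0ℓ
  SameColourEdge c u v = adj G u v ≡ true × c u ≡ c v

  Connected : Coloring N n → Rel (Fin n) 0ℓ
  Connected c = Star (SameColourEdge c)

  Connected-sym : ∀ {c : Coloring N n} {u v} → Connected c u v → Connected c v u
  Connected-sym = reverse λ (uv , cu≡cv) → trans (sym G _ _) uv , ≡.sym cu≡cv

  Connected-colour : ∀ {c : Coloring N n} {u v} → Connected c u v → c u ≡ c v
  Connected-colour ε                = refl
  Connected-colour ((_ , same) ◅ p) = trans same (Connected-colour p)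

  Connected-resp-≗ : ∀ {c c' : Coloring N n} → c ≗ c' → ∀ {u v} → Connected c u v → Connected c' u v
  Connected-resp-≗ c≗c' =
    Star.map λ (uv , same) → uv , trans (≡.sym (c≗c' _)) (trans same (c≗c' _))

  Connected-transport : ∀ {a} {c c' : Coloring N n} → (∀ w → c w ≡ a → c' w ≡ a) →
                        ∀ {x v} → c x ≡ a → Connected c x v → Connected c' x v
  Connected-transport keep cx≡a ε = ε
  Connected-transport keep cx≡a ((xy , same) ◅ p) =
    (xy , trans (keep _ cx≡a) (≡.sym (keep _ cy≡a))) ◅ Connected-transport keep cy≡a p
    where cy≡a = trans (≡.sym same) cx≡a

  Applicable-resp-≗ : ∀ (r : Rule N) {c c'} → c ≗ c' → Applicable G r c → Applicable G r c'
  Applicable-resp-≗ r c≗c' (u , v , uv , cu , cv) =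
    u , v , uv , trans (≡.sym (c≗c' u)) cu , trans (≡.sym (c≗c' v)) cv

  applicable? : ∀ (r : Rule N) c → Dec (Applicable G r c)
  applicable? (a ⇒ b) c =
    any? λ u → any? λ v → (adj G u v Bool.≟ true) ×-dec (c u ≟ a) ×-dec (c v ≟ b)

  terminal? : ∀ (R : List (Rule N)) c → Dec (Terminal G R c)
  terminal? R c = All.all? (λ r → ¬? (applicable? r c)) R

  forceStep-cases : ∀ (a b : Color N) c v →
    forceStep G (a ⇒ b) c v ≡ c v ⊎
    (c v ≡ b × forceStep G (a ⇒ b) c v ≡ a × ∃ λ u → adj G u v ≡ true × c u ≡ a)
  forceStep-cases a b c v with c v ≟ b | hasNbrOfColor G c a v in found
  ... | yes cv≡b | true  =
    inj₂ (cv≡b , refl , hasNbrOfColor-sound G c a v (Equivalence.from Bool.T-≡ found))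
  ... | yes _    | false = inj₁ refl
  ... | no _     | _     = inj₁ refl

  forceStep-keeps-from : ∀ (a b : Color N) c v → c v ≡ a → forceStep G (a ⇒ b) c v ≡ a
  forceStep-keeps-from a b c v cv≡a with forceStep-cases a b c v
  ... | inj₁ unchanged        = trans unchanged cv≡a
  ... | inj₂ (_ , forced , _) = forced

  forceSteps-cases : ∀ (a b : Color N) c k v →
    iter (forceStep G (a ⇒ b)) k c v ≡ c v ⊎ (c v ≡ b × iter (forceStep G (a ⇒ b)) k c v ≡ a)
  forceSteps-cases a b c zero    v = inj₁ refl
  forceSteps-cases a b c (suc k) v
    with forceStep-cases a b (iter (forceStep G (a ⇒ b)) k c) v | forceSteps-cases a b c k v
  ... | inj₁ now              | inj₁ before         = inj₁ (trans now before)
  ... | inj₁ now              | inj₂ (cv≡b , was-a) = inj₂ (cv≡b , trans now was-a)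
  ... | inj₂ (was-b , now , _) | inj₁ before        = inj₂ (trans (≡.sym before) was-b , now)
  ... | inj₂ (_ , now , _)    | inj₂ (cv≡b , _)     = inj₂ (cv≡b , now)

  forceStep-keeps-Connected : ∀ (a b : Color N) c {x v} → c v ≡ a →
    Connected c x v → Connected (forceStep G (a ⇒ b) c) x v
  forceStep-keeps-Connected a b c cv≡a x~v =
    Connected-transport (forceStep-keeps-from a b c) (trans (Connected-colour x~v) cv≡a) x~v

  -- The chain of forcings that reached v stays a-coloured.
  forceSteps-origin : ∀ (a b : Color N) c k v → iter (forceStep G (a ⇒ b)) k c v ≡ a →
    ∃ λ x → c x ≡ a × Connected (iter (forceStep G (a ⇒ b)) k c) x v
  forceSteps-origin a b c zero v cv≡a = v , cv≡a , ε
  forceSteps-origin a b c (suc k) v now-a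
    with forceStep-cases a b (iter (forceStep G (a ⇒ b)) k c) v
  ... | inj₁ unchanged =
    let was-a          = trans (≡.sym unchanged) now-a
        x , cx≡a , x~v = forceSteps-origin a b c k v was-a
    in  x , cx≡a , forceStep-keeps-Connected a b (iter (forceStep G (a ⇒ b)) k c) was-a x~v
  ... | inj₂ (_ , forced , u , uv , cu≡a) =
    let x , cx≡a , x~u = forceSteps-origin a b c k u cu≡a
        still-a        = forceStep-keeps-from a b (iter (forceStep G (a ⇒ b)) k c) u cu≡a
    in  x , cx≡a ,
        forceStep-keeps-Connected a b (iter (forceStep G (a ⇒ b)) k c) cu≡a x~u
          ◅◅ ((uv , trans still-a (≡.sym forced)) ◅ ε)

  module _ {a b : Color N} {c c' : Coloring N n} (step : PropStep G (a ⇒ b) c c') where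

    private
      forcings : ℕ
      forcings = proj₁ (proj₁ step)

      result : iter (forceStep G (a ⇒ b)) forcings c ≗ c'
      result = proj₂ (proj₁ step)

      inapplicable : ¬ Applicable G (a ⇒ b) c'
      inapplicable = proj₂ step

    propStep-cases : ∀ v → c' v ≡ c v ⊎ (c v ≡ b × c' v ≡ a)
    propStep-cases v with forceSteps-cases a b c forcings v
    ... | inj₁ unchanged       = inj₁ (trans (≡.sym (result v)) unchanged)
    ... | inj₂ (cv≡b , forced) = inj₂ (cv≡b , trans (≡.sym (result v)) forced)

    -- An edge whose ends got different colours would join an a-vertex to a
    -- b-vertex, which propagation rules out.
    propStep-SameColourEdge : ∀ {u v} → SameColourEdge c u v → SameColourEdge c' u v
    propStep-SameColourEdge {u} {v} (uv , same) =
      uv , sameAfter (propStep-cases u) (propStep-cases v)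
      where
      sameAfter : _ → _ → c' u ≡ c' v
      sameAfter (inj₁ u-kept)      (inj₁ v-kept)      = trans u-kept (trans same (≡.sym v-kept))
      sameAfter (inj₂ (_ , u-a))   (inj₂ (_ , v-a))   = trans u-a (≡.sym v-a)
      sameAfter (inj₁ u-kept)      (inj₂ (cv≡b , v-a)) =
        ⊥-elim (inapplicable (v , u , trans (sym G v u) uv , v-a , trans u-kept (trans same cv≡b)))
      sameAfter (inj₂ (cu≡b , u-a)) (inj₁ v-kept)     =
        ⊥-elim (inapplicable (u , v , uv , u-a , trans v-kept (trans (≡.sym same) cu≡b)))

    propStep-Connected : ∀ {u v} → Connected c u v → Connected c' u v
    propStep-Connected = Star.map propStep-SameColourEdge

    propStep-recolour-joins : ∀ w → c w ≢ c' w → ∃ λ x → Connected c' x w × ¬ Connected c x w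
    propStep-recolour-joins w recoloured with propStep-cases w
    ... | inj₁ kept = ⊥-elim (recoloured (≡.sym kept))
    ... | inj₂ (_ , c'w≡a) =
      let x , cx≡a , x~w = forceSteps-origin a b c forcings w (trans (result w) c'w≡a)
      in  x , Connected-resp-≗ result x~w , λ x~w-before →
            recoloured (trans (≡.sym (Connected-colour x~w-before)) (trans cx≡a (≡.sym c'w≡a)))

  NonLeast : Coloring N n → Fin n → Set
  NonLeast c v = ∃ λ u → u Fin.< v × Connected c u v

  ConnectedDecider : Coloring N n → Set
  ConnectedDecider c = ∀ u v → Dec (Connected c u v)

  ¬¬-connectedDecider : ∀ (c : Coloring N n) → ¬ ¬ ConnectedDecider c
  ¬¬-connectedDecider c = ¬¬-∀-Fin λ u → ¬¬-∀-Fin λ v → ¬¬-excluded-middle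

  module _ {c : Coloring N n} (D : ConnectedDecider c) where

    nonLeast? : Decidable (NonLeast c)
    nonLeast? v = any? λ u → (u Fin.<? v) ×-dec D u v

    nonLeasts : Subset n
    nonLeasts = fromDec nonLeast?

    ∣nonLeasts∣≤n∸1 : ∣ nonLeasts ∣ ≤ n ∸ 1
    ∣nonLeasts∣≤n∸1 = ∣p∣≤n∸1 nonLeasts λ v∈ → let u , u<v , _ = ∈-fromDec⁻ nonLeast? v∈ in u , u<v

    leastInComponent : ∀ v → ∃ λ r → ¬ NonLeast c r × Connected c r v
    leastInComponent v = go v (Fin.<-wellFounded v)
      where
      go : ∀ v → Acc Fin._<_ v → ∃ λ r → ¬ NonLeast c r × Connected c r v
      go v (acc smaller) with nonLeast? v
      ... | no  least-v             = v , least-v , ε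
      ... | yes (u , u<v , u~v) =
        let r , least-r , r~u = go u (smaller u<v) in r , least-r , r~u ◅◅ u~v

  -- Joining two components makes the larger of their least elements non-least.
  merge⇒newNonLeast : ∀ {c c' : Coloring N n} → ConnectedDecider c →
    (∀ {u v} → Connected c u v → Connected c' u v) →
    ∀ {x w} → Connected c' x w → ¬ Connected c x w → ∃ λ v → NonLeast c' v × ¬ NonLeast c v
  merge⇒newNonLeast D c⇒c' {x} {w} x~'w x≁w
    with leastInComponent D x | leastInComponent D w
  ... | rx , least-rx , rx~x | rw , least-rw , rw~w
    with <-cmp rx rw
  ... | tri< rx<rw _ _ = rw , (rx , rx<rw , rx~'rw) , least-rw
    where rx~'rw = c⇒c' rx~x ◅◅ x~'w ◅◅ Connected-sym (c⇒c' rw~w)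
  ... | tri≈ _ refl _ = ⊥-elim (x≁w (Connected-sym rx~x ◅◅ rw~w))
  ... | tri> _ _ rw<rx = rx , (rw , rw<rx , rw~'rx) , least-rx
    where rw~'rx = c⇒c' rw~w ◅◅ Connected-sym x~'w ◅◅ Connected-sym (c⇒c' rx~x)

  propStep-NonLeast : ∀ {r} {c c' : Coloring N n} → PropStep G r c c' →
                      ∀ {v} → NonLeast c v → NonLeast c' v
  propStep-NonLeast step (u , u<v , u~v) = u , u<v , propStep-Connected step u~v

  propStep-∣nonLeasts∣ : ∀ {r} {c c' : Coloring N n} → PropStep G r c c' →
    (D : ConnectedDecider c) (D' : ConnectedDecider c') →
    ∣ nonLeasts D ∣ + (if changedᵇ c c' then 1 else 0) ≤ ∣ nonLeasts D' ∣
  propStep-∣nonLeasts∣ {c = c} {c'} step D D' with changedᵇ c c' in changed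
  ... | false = ≤-trans (≤-reflexive (+-identityʳ _)) (p⊆q⇒∣p∣≤∣q∣
                  (fromDec-⊆ (nonLeast? D) (nonLeast? D') (propStep-NonLeast step)))
  ... | true  =
    let w , recoloured = changedᵇ-sound c c' (Equivalence.from Bool.T-≡ changed)
        x , x~'w , x≁w = propStep-recolour-joins step w recoloured
        v , new , old  = merge⇒newNonLeast D (propStep-Connected step) x~'w x≁w
    in  ≤-trans (≤-reflexive (+-comm _ 1)) (p⊂q⇒∣p∣<∣q∣
          (fromDec-⊂ (nonLeast? D) (nonLeast? D') (propStep-NonLeast step) new old))

module _ (seq : ℕ → Coloring N n) where

  numChanging-mono : ∀ {s t} → s ≤ t → numChanging seq s ≤ numChanging seq t
  numChanging-mono {t = zero}  z≤n = ≤-refl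
  numChanging-mono {t = suc t} s≤1+t with m≤n⇒m<n∨m≡n s≤1+t
  ... | inj₁ s<1+t = ≤-trans (numChanging-mono (≤-pred s<1+t)) (m≤m+n _ _)
  ... | inj₂ refl  = ≤-refl

  Changes : ℕ → Set
  Changes t = T (changedᵇ (seq t) (seq (suc t)))

  numChanging-step : ∀ {t} → Changes t → numChanging seq t < numChanging seq (suc t)
  numChanging-step {t} changed with changedᵇ (seq t) (seq (suc t))
  ... | true = ≤-reflexive (+-comm 1 _)

  module _ (G : SimpleGraph n) where

    StepsBelow : ℕ → Set
    StepsBelow T = ∀ {t} → t < T → ∃ λ r → PropStep G r (seq t) (seq (suc t))

    numChanging≤∣nonLeasts∣ : ∀ T → StepsBelow T → (D : ConnectedDecider G (seq T)) →
                              ¬ ¬ (numChanging seq T ≤ ∣ nonLeasts G D ∣)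
    numChanging≤∣nonLeasts∣ zero    _     _ ¬le = ¬le z≤n
    numChanging≤∣nonLeasts∣ (suc T) steps D ¬le =
      ¬¬-connectedDecider G (seq T) λ D₀ →
      numChanging≤∣nonLeasts∣ T (steps ∘ m≤n⇒m≤1+n) D₀ λ ih →
      ¬le (≤-trans (+-monoˡ-≤ _ ih) (propStep-∣nonLeasts∣ G (proj₂ (steps ≤-refl)) D₀ D))

    -- Connectivity is decided only classically (by double negation), which
    -- suffices because the inequality itself is decidable.
    numChanging≤n∸1 : ∀ T → StepsBelow T → numChanging seq T ≤ n ∸ 1
    numChanging≤n∸1 T steps = decidable-stable (_ ≤? _) λ ¬le →
      ¬¬-connectedDecider G (seq T) λ D →
      numChanging≤∣nonLeasts∣ T steps D λ le →
      ¬le (≤-trans le (∣nonLeasts∣≤n∸1 G D))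

    RunSteps : List (Rule N) → Set
    RunSteps R = ∀ t r → ruleAt R t ≡ just r → PropStep G r (seq t) (seq (suc t))

    nonTerminal⇒step : ∀ {R} → RunSteps R → ∀ {t} → ¬ Terminal G R (seq t) →
                       ∃ λ r → PropStep G r (seq t) (seq (suc t))
    nonTerminal⇒step {[]}    _   nonTerminal = ⊥-elim (nonTerminal [])
    nonTerminal⇒step {_ ∷ _} run _           = _ , run _ _ refl

    module Rounds (r : Rule N) (rs : List (Rule N)) (run : RunSteps (r ∷ rs)) where

      private
        R = r ∷ rs
        m = length R

      ruleAt-round : ∀ (j : Fin m) q → ruleAt R (toℕ j + q * m) ≡ just (lookup R j)
      ruleAt-round j q = cong (just ∘ lookup R) (toℕ-injective (begin
        toℕ (fromℕ< _)        ≡⟨ toℕ-fromℕ< _ ⟩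
        (toℕ j + q * m) ℕ.% m ≡⟨ [m+kn]%n≡m%n (toℕ j) q m ⟩
        toℕ j ℕ.% m           ≡⟨ m<n⇒m%n≡m (toℕ<n j) ⟩
        toℕ j                 ∎))
        where open ≡.≡-Reasoning

      Noisy : ℕ → Set
      Noisy q = ∃ λ i → i < m × Changes (i + q * m)

      noisy? : Decidable Noisy
      noisy? q = anyUpTo? (λ i → T? (changedᵇ (seq (i + q * m)) (seq (suc i + q * m)))) m

      quiet-constant : ∀ q → ¬ Noisy q → ∀ i → i ≤ m → seq (i + q * m) ≗ seq (q * m)
      quiet-constant q quiet zero    _     v = refl
      quiet-constant q quiet (suc i) 1+i≤m v =
        trans (≡.sym (changedᵇ-complete (seq (i + q * m)) _ unchanged v))
              (quiet-constant q quiet i (<⇒≤ 1+i≤m) v)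
        where unchanged = λ changes → quiet (i , 1+i≤m , changes)

      quiet⇒Terminal : ∀ q → ¬ Noisy q → Terminal G R (seq (q * m))
      quiet⇒Terminal q quiet = All.tabulate λ r∈R →
        subst (λ r → ¬ Applicable G r (seq (q * m))) (≡.sym (lookup-index r∈R))
              (inapplicable (Any.index r∈R))
        where
        inapplicable : ∀ j → ¬ Applicable G (lookup R j) (seq (q * m))
        inapplicable j =
          proj₂ (run _ _ (ruleAt-round j q)) ∘
          Applicable-resp-≗ G (lookup R j) (≡.sym ∘ quiet-constant q quiet (suc (toℕ j)) (toℕ<n j))

      noisy⇒numChanging< : ∀ q → Noisy q → numChanging seq (q * m) < numChanging seq (suc q * m)
      noisy⇒numChanging< q (i , i<m , changes) = begin-strict
        numChanging seq (q * m)         ≤⟨ numChanging-mono (m≤n+m _ i) ⟩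
        numChanging seq (i + q * m)     <⟨ numChanging-step changes ⟩
        numChanging seq (suc i + q * m) ≤⟨ numChanging-mono (+-monoˡ-≤ (q * m) i<m) ⟩
        numChanging seq (m + q * m)     ∎
        where open ≤-Reasoning

      noisyRounds : ∀ Q → (∀ q → q < Q → Noisy q) → Q ≤ numChanging seq (Q * m)
      noisyRounds zero    _     = z≤n
      noisyRounds (suc Q) noisy =
        ≤-trans (s≤s (noisyRounds Q λ q → noisy q ∘ m≤n⇒m≤1+n))
                (noisy⇒numChanging< Q (noisy Q ≤-refl))

      -- Each round with a change adds to numChanging, which is at most n ∸ 1.
      someRoundQuiet : ∃ λ T → Terminal G R (seq T)
      someRoundQuiet with anyUpTo? (¬? ∘ noisy?) (suc n)
      ... | yes (q , _ , quiet) = q * m , quiet⇒Terminal q quiet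
      ... | no  allNoisy        = ⊥-elim (1+n≰n (begin
        suc n                          ≤⟨ noisyRounds (suc n) noisy ⟩
        numChanging seq (suc n * m)    ≤⟨ numChanging≤n∸1 (suc n * m) (λ _ → _ , run _ _ refl) ⟩
        n ∸ 1                          ≤⟨ m∸n≤m n 1 ⟩
        n                              ∎))
        where
        open ≤-Reasoning
        noisy : ∀ q → q < suc n → Noisy q
        noisy q q<1+n = decidable-stable (noisy? q) λ quiet → allNoisy (q , q<1+n , quiet)

    eventuallyTerminal : ∀ {R} → RunSteps R → ∃ λ T → Terminal G R (seq T)
    eventuallyTerminal {[]}     _   = 0 , []
    eventuallyTerminal {r ∷ rs} run = Rounds.someRoundQuiet r rs run

theorem3p2 : ∀ {N n : ℕ} (F : ForcingNetwork N) (G : SimpleGraph n)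
    (col₀ : Coloring N n) → ColoredBy (X F) col₀ →
    (seq : ℕ → Coloring N n) → IsRun G (rules F) col₀ seq →
    ∃ λ T → Terminal G (rules F) (seq T)
      × (∀ t → t < T → ¬ Terminal G (rules F) (seq t))
      × numChanging seq T ≤ n ∸ 1
theorem3p2 F G _ _ seq (_ , run) =
  let T , terminal , minimal =
        leastWitness (terminal? G (rules F) ∘ seq) (proj₂ (eventuallyTerminal seq G run))
  in  T , terminal , minimal ,
      numChanging≤n∸1 seq G T λ t<T → nonTerminal⇒step seq G run (minimal _ t<T)
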